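{- Let $P(q,z,t)=\sum_{\pi} z^{|\pi|}q^{|123(\pi)|}t^{|12(\pi)|}$, the sum over all $(132)$-avoiding permutations $\pi$ (including the empty one). Let $B(q,z,t)=\sum_{m\ge 0}\phi_m(q,t)z^m$ be the denominator of $P$, i.e. the formal series with $\phi_0=1$ satisfying \[B(q,z,t)=B(q,zt,tq)-z\,B(q,t^2qz,tq^2),\] so that $P(q,z,t)=B(q,zt,tq)/B(q,z,t)$. Then \[ B(q,z,t)=1+\sum_{m=1}^{\infty}\left(-zq^3t^{ -2}\right)^m\sum_{j_1,\dots,j_m\ge 2} t^{\sum_{r=1}^m r j_r}\, q^{\frac12\left\{\sum_{r,s=1}^m \min(r,s)\, j_r j_s \;-\;5\sum_{r=1}^m r j_r\right\}}. \]
   Context: For a permutation $\pi$ of $\{1,\dots,n\}$: $|\pi|=n$; $|12(\pi)|$ is the number of pairs $i<j$ with $\pi(i)<\pi(j)$; $|123(\pi)|$ is the number of triples $i<j<k$ with $\pi(i)<\pi(j)<\pi(k)$; $\pi$ is $(132)$-avoiding if there is no triple $i<j<k$ with $\pi(i)<\pi(k)<\pi(j)$. The series $P$ satisfies $P(q,z,t)=1/(1-zP(q,zt,tq))$, and writing $P=A/B$ one has $A(q,z,t)=B(q,zt,tq)$; equivalently the coefficients satisfy $\phi_0=1$ and $\phi_m(q,t)=t^m\phi_m(q,qt)-t^{2m-2}q^{m-1}\phi_{m-1}(q,tq^2)$ for $m\ge1$, with each $\phi_m$ a formal power series in $t$. -}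

module Defs where

open import Data.Nat as ℕ using (ℕ; zero; suc; _+_; _*_; _∸_; _⊓_; _≤ᵇ_; _≡ᵇ_)
open import Data.Integer as ℤ using (ℤ; +_; -[1+_])
open import Data.Bool using (Bool; true; false; if_then_else_; _∧_)
open import Data.List using (List; []; _∷_; map; concatMap; upTo)
open import Data.Nat.ListAction using (sum)
open import Data.Product using (_×_; _,_)
open import Relation.Nullary using (does)

-- A formal power series in z, t, q with integer coefficients
-- (the ring in which B(q,z,t) = Σ φ_m(q,t) z^m lives):
-- B m n k = coefficient of z^m t^n q^k.
Series : Set
Series = ℕ → ℕ → ℕ → ℤ

oneCoeff : ℕ → ℕ → ℤ
oneCoeff n k = if (n ≡ᵇ 0) ∧ (k ≡ᵇ 0) then + 1 else + 0

-- coefficients of B(q, z t, t q):  z^m t^n q^k  ↦  z^m t^(m+n) q^(n+k)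
substA : Series → Series
substA B m n k =
  if (m ≤ᵇ n) ∧ ((n ∸ m) ≤ᵇ k) then B m (n ∸ m) (k ∸ (n ∸ m)) else + 0

-- coefficients of z · B(q, t²q z, t q²):  z^m t^n q^k  ↦  z^(m+1) t^(2m+n) q^(m+2n+k)
substB : Series → Series
substB B zero n k = + 0
substB B (suc m) n k =
  if (2 * m ≤ᵇ n) ∧ ((m + 2 * (n ∸ 2 * m)) ≤ᵇ k)
  then B m (n ∸ 2 * m) (k ∸ (m + 2 * (n ∸ 2 * m)))
  else + 0

extend : Series → ℕ → ℤ → ℤ → ℤ
extend B m (+ n) (+ k) = B m n k
extend B m (+ n) -[1+ k ] = + 0
extend B m -[1+ n ] k = + 0

indexedFrom : ℕ → List ℕ → List (ℕ × ℕ)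
indexedFrom r [] = []
indexedFrom r (j ∷ js) = (r , j) ∷ indexedFrom (suc r) js

indexed : List ℕ → List (ℕ × ℕ)
indexed = indexedFrom 1

linW : List (ℕ × ℕ) → ℕ
linW ps = sum (map (λ { (r , j) → r * j }) ps)

quadW : List (ℕ × ℕ) → ℕ
quadW ps = sum (map (λ { (r , j) → sum (map (λ { (s , i) → (r ⊓ s) * j * i }) ps) }) ps)

listsOver : List ℕ → ℕ → List (List ℕ)
listsOver xs zero = [] ∷ []
listsOver xs (suc m) = concatMap (λ x → map (x ∷_) (listsOver xs m)) xs

range2 : ℕ → List ℕ
range2 b = map (λ i → 2 + i) (upTo (b ∸ 1))

tuples : ℕ → ℕ → List (List ℕ)
tuples m b = listsOver (range2 b) m

-- does the tuple js contribute the monomial t^n q^k in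
-- (q³ t⁻²)^m t^(Σ r j_r) q^(½{Σ min(r,s) j_r j_s − 5 Σ r j_r}) ?
-- (t-exponent Σ r j_r − 2m; q-exponent 3m + ½(Q − 5L), compared after doubling)
contributes : ℕ → ℤ → ℤ → List ℕ → Bool
contributes m n k js =
  does (n ℤ.≟ ((+ L) ℤ.- (+ (2 * m))))
  ∧ does (((+ 2) ℤ.* k) ℤ.≟ ((+ (6 * m + Q)) ℤ.- (+ (5 * L))))
  where
  L = linW (indexed js)
  Q = quadW (indexed js)

countᵇ : {A : Set} → (A → Bool) → List A → ℕ
countᵇ p [] = 0
countᵇ p (x ∷ xs) = if p x then suc (countᵇ p xs) else countᵇ p xs

sign : ℕ → ℤ
sign zero = + 1
sign (suc m) = ℤ.- sign m

-- coefficient of z^m t^n q^k of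
--   1 + Σ_{m≥1} (−z q³ t⁻²)^m Σ_{j_1,…,j_m ≥ 2} t^(Σ r j_r) q^(½{…})
-- For fixed n only tuples with Σ r j_r = n + 2m contribute, and all their
-- entries are ≤ n + 2m ≤ ∣n∣ + 2m, so the enumeration below is exhaustive.
rhsCoeff : ℕ → ℤ → ℤ → ℤ
rhsCoeff zero n k = if does (n ℤ.≟ + 0) ∧ does (k ℤ.≟ + 0) then + 1 else + 0
rhsCoeff (suc m) n k =
  sign (suc m) ℤ.* (+ countᵇ (contributes (suc m) n k) (tuples (suc m) (ℤ.∣ n ∣ + 2 * suc m)))

{-# OPTIONS --safe #-}
-- Write c(m, n, k) for the coefficient of z^m t^n q^k, with n and k ranging over ℤ.  The functional
-- equation says c(m+1, n, k) = c(m+1, n−m−1, k−n+m+1) − c(m, n−2m, k−m−2(n−2m)); together with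
-- c(0, n, k) = [n = k = 0] and c(m, n, k) = 0 for n < 0 this determines c by induction on n, and the
-- coefficients of B, extended by zero, form one solution.  So it suffices that the right-hand side
-- solves the same recurrence.  Its coefficient is (−1)^m times the number of tuples j₁,…,j_m ≥ 2 with
-- Σ r j_r − 2m = n and 3m + ½(Σ min(r,s) j_r j_s − 5 Σ r j_r) = k; every entry is at most
-- Σ r j_r = n + 2m, so any enumeration bound beyond that counts the same tuples.  Sorting the tuples
-- of length m+1 by their last entry, deleting a last entry 2 is a bijection onto the tuples counted at
-- (m, n−2m, k−m−2(n−2m)), and lowering a last entry ≥ 3 by one is a bijection onto those counted at
-- (m+1, n−m−1, k−n+m+1); with the sign (−1)^(m+1) this is the recurrence.
module Submission where

open import Defs
open import Data.Bool using (Bool; true; false; if_then_else_; _∧_)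
open import Data.Integer as ℤ using (ℤ; +_; -[1+_]; _-_; ∣_∣)
import Data.Integer.Properties as ℤ
import Data.Integer.Tactic.RingSolver as ℤ-Ring
open import Data.List as List using (List; []; _∷_; _++_; _∷ʳ_; [_]; map; concatMap; length; upTo)
open import Data.List.Properties using (map-++; map-cong; map-cong-local; map-∘; map-applyUpTo; upTo-∷ʳ)
open import Data.List.Relation.Unary.All as All using (All; []; _∷_)
import Data.List.Relation.Unary.All.Properties as All
open import Data.Nat as ℕ using (ℕ; zero; suc; _∸_; _≤_; _<_; _⊓_; _≤ᵇ_; s≤s; z<s)
open import Data.Nat.Induction using (<-rec)
open import Data.Nat.ListAction using (sum)
open import Data.Nat.ListAction.Properties using (sum-++)
open import Data.Nat.Properties
open import Data.Nat.Tactic.RingSolver using (solve-∀)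
open import Data.Product using (_×_; _,_; proj₁; proj₂)
open import Function using (_∘_; _⇔_; mk⇔)
open import Relation.Binary.PropositionalEquality
  using (_≡_; refl; sym; trans; cong; cong₂; subst; module ≡-Reasoning)
open import Relation.Nullary using (¬_; contradiction; Dec; yes; does; ofʸ; ofⁿ)
open import Relation.Nullary.Decidable using (does-⇔; _×-dec_; map′)

module _ where
  open import Data.Integer using (_+_; _*_)

  ≡-by-difference : ∀ {a b c d : ℤ} → a - b ≡ c - d → a ≡ b → c ≡ d
  ≡-by-difference {a} {b} {c} {d} eq a≡b = ℤ.i-j≡0⇒i≡j c d (trans (sym eq) (ℤ.i≡j⇒i-j≡0 a≡b))

  pos-minus-≥ : ∀ {a b} → b ≤ a → + a - + b ≡ + (a ∸ b)
  pos-minus-≥ {a} {b} b≤a = trans (ℤ.[+m]-[+n]≡m⊖n a b) (ℤ.⊖-≥ b≤a)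

  pos-minus-< : ∀ {a b} → a < b → + a - + b ≡ -[1+ (b ∸ suc a) ]
  pos-minus-< {a} {suc b} (s≤s a≤b) =
    trans (ℤ.[+m]-[+n]≡m⊖n a (suc b))
          (trans (ℤ.⊖-< (s≤s a≤b)) (cong (ℤ.-_ ∘ +_) (+-∸-assoc 1 a≤b)))

  data DifferenceView (a b : ℕ) : Bool → ℤ → Set where
    nonneg : b ≤ a → DifferenceView a b true (+ (a ∸ b))
    neg    : ∀ {j} → DifferenceView a b false -[1+ j ]

  differenceView : ∀ a b → DifferenceView a b (b ≤ᵇ a) (+ a - + b)
  differenceView a b with b ≤ᵇ a | ≤ᵇ-reflects-≤ b a
  ... | true  | ofʸ b≤a = subst (DifferenceView a b true) (sym (pos-minus-≥ b≤a)) (nonneg b≤a)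
  ... | false | ofⁿ b≰a = subst (DifferenceView a b false) (sym (pos-minus-< (≰⇒> b≰a))) neg

  -- The coefficient of z^(m+1) t^n q^k in B(q,z,t) = B(q,zt,tq) − z B(q,t²qz,tq²), for integer n and k.
  Recurrence : (ℕ → ℤ → ℤ → ℤ) → ℕ → ℤ → ℤ → Set
  Recurrence X m n k =
    X (suc m) n k ≡ X (suc m) (n - + suc m) (k - (n - + suc m))
                    - X m (n - + 2 * + m) (k - (+ m + + 2 * (n - + 2 * + m)))

  record SolvesRecurrence (X : ℕ → ℤ → ℤ → ℤ) : Set where
    field
      initial  : ∀ n k → X 0 n k ≡ rhsCoeff 0 n k
      negative : ∀ m a k → X m -[1+ a ] k ≡ + 0
      step     : ∀ m n k → Recurrence X m n k

  -- Induction on the t-exponent: both terms of the recurrence lower it, except the second one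
  -- for m = 0, which is fixed by the initial condition.
  solutions-agree : ∀ {X Y} → SolvesRecurrence X → SolvesRecurrence Y → ∀ m n k → X m n k ≡ Y m n k
  solutions-agree {X} {Y} X-solves Y-solves = agree
    where
    module X = SolvesRecurrence X-solves
    module Y = SolvesRecurrence Y-solves
    Agree : ℕ → Set
    Agree a = ∀ m k → X m (+ a) k ≡ Y m (+ a) k
    agree-at : ∀ a → (∀ {b} → b < a → Agree b) → Agree a
    agree-at a ih zero    k = trans (X.initial (+ a) k) (sym (Y.initial (+ a) k))
    agree-at a ih (suc m) k =
      trans (X.step m (+ a) k)
            (trans (cong₂ _-_ (agree-below (suc m) m _) (agree-second m)) (sym (Y.step m (+ a) k)))
      where
      agree-below : ∀ m d k → X m (+ a - + suc d) k ≡ Y m (+ a - + suc d) k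
      agree-below m d k with suc d ≤ᵇ a | + a - + suc d | differenceView a (suc d)
      ... | true  | _ | nonneg d<a = ih (∸-monoʳ-< z<s d<a) m k
      ... | false | _ | neg        = trans (X.negative m _ k) (sym (Y.negative m _ k))
      agree-second : ∀ m → let n₂ = + a - + 2 * + m
                           in X m n₂ (k - (+ m + + 2 * n₂)) ≡ Y m n₂ (k - (+ m + + 2 * n₂))
      agree-second zero    = trans (X.initial _ _) (sym (Y.initial _ _))
      agree-second (suc m) = agree-below (suc m) _ _
    agree : ∀ m n k → X m n k ≡ Y m n k
    agree m (+ a)    k = <-rec Agree agree-at a m k
    agree m -[1+ a ] k = trans (X.negative m a k) (sym (Y.negative m a k))

  record Admissible (m n k L Q : ℤ) : Set where
    constructor admissible
    field
      t-exponent : n ≡ L - + 2 * m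
      q-exponent : + 2 * k ≡ + 6 * m + Q - + 5 * L

  admissible? : ∀ m n k L Q → Dec (Admissible m n k L Q)
  admissible? m n k L Q =
    map′ (λ (e₁ , e₂) → admissible e₁ e₂) (λ (admissible e₁ e₂) → e₁ , e₂)
         (n ℤ.≟ L - + 2 * m ×-dec + 2 * k ℤ.≟ + 6 * m + Q - + 5 * L)

  admissible-⇔ : ∀ {m n k L Q m′ n′ k′ L′ Q′} →
    n - (L - + 2 * m) ≡ n′ - (L′ - + 2 * m′) →
    (n ≡ L - + 2 * m → + 2 * k - (+ 6 * m + Q - + 5 * L) ≡ + 2 * k′ - (+ 6 * m′ + Q′ - + 5 * L′)) →
    Admissible m n k L Q ⇔ Admissible m′ n′ k′ L′ Q′
  admissible-⇔ t-defect q-defect = mk⇔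
    (λ (admissible e₁ e₂) → admissible (≡-by-difference t-defect e₁)
                                       (≡-by-difference (q-defect e₁) e₂))
    (λ (admissible e₁ e₂) → let e₁′ = ≡-by-difference (sym t-defect) e₁
                            in admissible e₁′ (≡-by-difference (sym (q-defect e₁′)) e₂))

  -- Appending an entry x to a tuple of length s − 1 turns (L, Q) into (L + s x, Q + 2 L x + s x²).
  admissible-∷ʳ-2 : ∀ s n k L Q →
    Admissible (+ 1 + s) n k (L + (+ 1 + s) * + 2) (Q + + 2 * (L * + 2) + (+ 1 + s) * + 2 * + 2)
    ⇔ Admissible s (n - + 2 * s) (k - (s + + 2 * (n - + 2 * s))) L Q
  admissible-∷ʳ-2 s n k L Q = admissible-⇔ (t-defect s n L) (q-defect s n k L Q)
    where
    t-defect : ∀ s n L → n - (L + (+ 1 + s) * + 2 - + 2 * (+ 1 + s)) ≡ n - + 2 * s - (L - + 2 * s)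
    t-defect = ℤ-Ring.solve-∀
    q-defect : ∀ s n k L Q → n ≡ L + (+ 1 + s) * + 2 - + 2 * (+ 1 + s) →
      + 2 * k - (+ 6 * (+ 1 + s) + (Q + + 2 * (L * + 2) + (+ 1 + s) * + 2 * + 2) - + 5 * (L + (+ 1 + s) * + 2))
      ≡ + 2 * (k - (s + + 2 * (n - + 2 * s))) - (+ 6 * s + Q - + 5 * L)
    q-defect s _ k L Q refl = ℤ-Ring.solve (s List.∷ k List.∷ L List.∷ Q List.∷ List.[])

  admissible-∷ʳ-suc : ∀ s n k L Q x →
    Admissible s n k (L + s * (+ 1 + x)) (Q + + 2 * (L * (+ 1 + x)) + s * (+ 1 + x) * (+ 1 + x))
    ⇔ Admissible s (n - s) (k - (n - s)) (L + s * x) (Q + + 2 * (L * x) + s * x * x)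
  admissible-∷ʳ-suc s n k L Q x = admissible-⇔ (t-defect s n L x) (q-defect s n k L Q x)
    where
    t-defect : ∀ s n L x → n - (L + s * (+ 1 + x) - + 2 * s) ≡ n - s - (L + s * x - + 2 * s)
    t-defect = ℤ-Ring.solve-∀
    q-defect : ∀ s n k L Q x → n ≡ L + s * (+ 1 + x) - + 2 * s →
      + 2 * k - (+ 6 * s + (Q + + 2 * (L * (+ 1 + x)) + s * (+ 1 + x) * (+ 1 + x)) - + 5 * (L + s * (+ 1 + x)))
      ≡ + 2 * (k - (n - s)) - (+ 6 * s + (Q + + 2 * (L * x) + s * x * x) - + 5 * (L + s * x))
    q-defect s _ k L Q x refl = ℤ-Ring.solve (s List.∷ k List.∷ L List.∷ Q List.∷ x List.∷ List.[])

open import Data.Nat using (_+_; _*_)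

private
  variable
    A B : Set

does-true : (a? : Dec A) → does a? ≡ true → A
does-true (yes a) _ = a

sum-map-+ : ∀ (f g : A → ℕ) xs →
            sum (map (λ x → f x + g x) xs) ≡ sum (map f xs) + sum (map g xs)
sum-map-+ f g []       = refl
sum-map-+ f g (x ∷ xs) = begin
  f x + g x + sum (map (λ x → f x + g x) xs)  ≡⟨ cong (_+_ (f x + g x)) (sum-map-+ f g xs) ⟩
  f x + g x + (sum (map f xs) + sum (map g xs)) ≡⟨ +-interchange (f x) (g x) _ _ ⟩
  f x + sum (map f xs) + (g x + sum (map g xs)) ∎
  where
  open ≡-Reasoning
  +-interchange : ∀ a b c d → a + b + (c + d) ≡ a + c + (b + d)
  +-interchange = solve-∀

sum-map-*ʳ : ∀ (f : A → ℕ) c xs → sum (map (λ x → f x * c) xs) ≡ sum (map f xs) * c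
sum-map-*ʳ f c []       = refl
sum-map-*ʳ f c (x ∷ xs) =
  trans (cong (_+_ (f x * c)) (sum-map-*ʳ f c xs)) (sym (*-distribʳ-+ c (f x) _))

sum-map-∷ʳ : ∀ (f : A → ℕ) xs x → sum (map f (xs ∷ʳ x)) ≡ sum (map f xs) + f x
sum-map-∷ʳ f xs x =
  trans (cong sum (map-++ f xs [ x ]))
        (trans (sum-++ (map f xs) [ f x ]) (cong (_+_ (sum (map f xs))) (+-identityʳ (f x))))

sum-map-zero : ∀ {f : A → ℕ} {xs} → All (λ x → f x ≡ 0) xs → sum (map f xs) ≡ 0
sum-map-zero []         = refl
sum-map-zero (fx≡0 ∷ h) = cong₂ _+_ fx≡0 (sum-map-zero h)

sum-map-swap : ∀ (f : A → B → ℕ) xs ys →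
               sum (map (λ x → sum (map (f x) ys)) xs) ≡ sum (map (λ y → sum (map (λ x → f x y) xs)) ys)
sum-map-swap f []       ys = sym (sum-map-zero (All.universal (λ _ → refl) ys))
sum-map-swap f (x ∷ xs) ys =
  trans (cong (_+_ (sum (map (f x) ys))) (sum-map-swap f xs ys))
        (sym (sum-map-+ (f x) (λ y → sum (map (λ x → f x y) xs)) ys))

count-++ : ∀ (p : A → Bool) xs ys → countᵇ p (xs ++ ys) ≡ countᵇ p xs + countᵇ p ys
count-++ p []       ys = refl
count-++ p (x ∷ xs) ys with p x
... | true  = cong suc (count-++ p xs ys)
... | false = count-++ p xs ys

count-cong-local : ∀ {p q : A → Bool} {xs} → All (λ x → p x ≡ q x) xs → countᵇ p xs ≡ countᵇ q xs
count-cong-local []         = refl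
count-cong-local (px≡qx ∷ h) = cong₂ (λ b n → if b then suc n else n) px≡qx (count-cong-local h)

count-none : ∀ {p : A → Bool} {xs} → All (λ x → p x ≡ false) xs → countᵇ p xs ≡ 0
count-none []          = refl
count-none (px≡false ∷ h) rewrite px≡false = count-none h

count-concatMap : ∀ (p : B → Bool) (f : A → List B) xs →
                  countᵇ p (concatMap f xs) ≡ sum (map (countᵇ p ∘ f) xs)
count-concatMap p f []       = refl
count-concatMap p f (x ∷ xs) = trans (count-++ p (f x) _) (cong (_+_ (countᵇ p (f x))) (count-concatMap p f xs))

count-map : ∀ (p : B → Bool) (f : A → B) xs → countᵇ p (map f xs) ≡ countᵇ (p ∘ f) xs
count-map p f []       = refl
count-map p f (x ∷ xs) = cong (λ n → if p (f x) then suc n else n) (count-map p f xs)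

listsOver-All : ∀ {P : ℕ → Set} {xs} m → All P xs →
                All (λ js → length js ≡ m × All P js) (listsOver xs m)
listsOver-All zero    pxs = (refl , []) ∷ []
listsOver-All (suc m) pxs =
  All.concat⁺ (All.map⁺ (All.map (λ px → All.map⁺ (All.map (λ (len , pjs) → cong suc len , px ∷ pjs)
                                                            (listsOver-All m pxs)))
                                 pxs))

count-listsOver-cong : ∀ {P : ℕ → Set} {xs} m {p q : List ℕ → Bool} → All P xs →
                       (∀ js → length js ≡ m → All P js → p js ≡ q js) →
                       countᵇ p (listsOver xs m) ≡ countᵇ q (listsOver xs m)
count-listsOver-cong m pxs h = count-cong-local (All.map (λ (len , pjs) → h _ len pjs) (listsOver-All m pxs))

count-listsOver-suc : ∀ (p : List ℕ → Bool) xs m →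
                      countᵇ p (listsOver xs (suc m))
                      ≡ sum (map (λ x → countᵇ (p ∘ (x ∷_)) (listsOver xs m)) xs)
count-listsOver-suc p xs m =
  trans (count-concatMap p (λ x → map (x ∷_) (listsOver xs m)) xs)
        (cong sum (map-cong (λ x → count-map p (x ∷_) (listsOver xs m)) xs))

count-listsOver-∷ʳ : ∀ (p : List ℕ → Bool) xs m →
                     countᵇ p (listsOver xs (suc m))
                     ≡ sum (map (λ x → countᵇ (p ∘ (_∷ʳ x)) (listsOver xs m)) xs)
count-listsOver-∷ʳ p xs zero    = count-listsOver-suc p xs zero
count-listsOver-∷ʳ p xs (suc m) = begin
  countᵇ p (listsOver xs (2 + m))
    ≡⟨ count-listsOver-suc p xs (suc m) ⟩
  sum (map (λ y → countᵇ (p ∘ (y ∷_)) (listsOver xs (suc m))) xs)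
    ≡⟨ cong sum (map-cong (λ y → count-listsOver-∷ʳ (p ∘ (y ∷_)) xs m) xs) ⟩
  sum (map (λ y → sum (map (λ x → countᵇ (λ js → p (y ∷ js ∷ʳ x)) (listsOver xs m)) xs)) xs)
    ≡⟨ sum-map-swap (λ y x → countᵇ (λ js → p (y ∷ js ∷ʳ x)) (listsOver xs m)) xs xs ⟩
  sum (map (λ x → sum (map (λ y → countᵇ (λ js → p (y ∷ js ∷ʳ x)) (listsOver xs m)) xs)) xs)
    ≡⟨ cong sum (map-cong (λ x → sym (count-listsOver-suc (p ∘ (_∷ʳ x)) xs m)) xs) ⟩
  sum (map (λ x → countᵇ (p ∘ (_∷ʳ x)) (listsOver xs (suc m))) xs) ∎
  where open ≡-Reasoning

count-listsOver-++ : ∀ {P : ℕ → Set} (p : List ℕ → Bool) xs {ys} m →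
                     (∀ js → p js ≡ true → All P js) → All (¬_ ∘ P) ys →
                     countᵇ p (listsOver (xs ++ ys) m) ≡ countᵇ p (listsOver xs m)
count-listsOver-++ p xs zero    p⇒P ¬Pys = refl
count-listsOver-++ {P} p xs {ys} (suc m) p⇒P ¬Pys = begin
  countᵇ p (listsOver (xs ++ ys) (suc m))
    ≡⟨ count-listsOver-suc p (xs ++ ys) m ⟩
  sum (map f (xs ++ ys))
    ≡⟨ trans (cong sum (map-++ f xs ys)) (sum-++ (map f xs) (map f ys)) ⟩
  sum (map f xs) + sum (map f ys)
    ≡⟨ cong₂ _+_ (cong sum (map-cong shrink xs)) (sum-map-zero (All.map never ¬Pys)) ⟩
  sum (map (λ x → countᵇ (p ∘ (x ∷_)) (listsOver xs m)) xs) + 0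
    ≡⟨ +-identityʳ _ ⟩
  sum (map (λ x → countᵇ (p ∘ (x ∷_)) (listsOver xs m)) xs)
    ≡⟨ count-listsOver-suc p xs m ⟨
  countᵇ p (listsOver xs (suc m)) ∎
  where
  open ≡-Reasoning
  f : ℕ → ℕ
  f x = countᵇ (p ∘ (x ∷_)) (listsOver (xs ++ ys) m)
  shrink : ∀ x → f x ≡ countᵇ (p ∘ (x ∷_)) (listsOver xs m)
  shrink x = count-listsOver-++ (p ∘ (x ∷_)) xs m (λ js h → All.tail (p⇒P (x ∷ js) h)) ¬Pys
  never : ∀ {y} → ¬ P y → f y ≡ 0
  never {y} ¬Py = count-none (All.universal rejects (listsOver (xs ++ ys) m))
    where
    rejects : ∀ js → p (y ∷ js) ≡ false
    rejects js with p (y ∷ js) in eq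
    ... | true  = contradiction (All.head (p⇒P (y ∷ js) eq)) ¬Py
    ... | false = refl

All-range2 : ∀ b → All (2 ≤_) (range2 b)
All-range2 b = All.map⁺ (All.universal (λ i → m≤m+n 2 i) _)

range2-∷ʳ : ∀ b → range2 (2 + b) ≡ range2 (1 + b) ∷ʳ (2 + b)
range2-∷ʳ b = trans (cong (map (_+_ 2)) (sym (upTo-∷ʳ b))) (map-++ (_+_ 2) (upTo b) [ b ])

range2-2∷ : ∀ d → range2 (2 + d) ≡ 2 ∷ map suc (range2 (1 + d))
range2-2∷ d = cong (2 ∷_) (trans (map-applyUpTo suc (_+_ 2) d)
                                 (sym (trans (sym (map-∘ (upTo d))) (map-applyUpTo (λ i → i) (_+_ 3) d))))

count-tuples-suc : ∀ {c} b m (p : List ℕ → Bool) → c ≤ b →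
                   (∀ js → p js ≡ true → All (_≤ c) js) →
                   countᵇ p (tuples m (suc b)) ≡ countᵇ p (tuples m b)
count-tuples-suc zero    m p c≤b p⇒≤c = refl
count-tuples-suc (suc b) m p c≤b p⇒≤c =
  trans (cong (λ xs → countᵇ p (listsOver xs m)) (range2-∷ʳ b))
        (count-listsOver-++ p (range2 (suc b)) m p⇒≤c ((λ 2+b≤c → <⇒≱ (s≤s c≤b) 2+b≤c) ∷ []))

count-tuples-bound : ∀ {c} b m (p : List ℕ → Bool) → c ≤ b →
                     (∀ js → p js ≡ true → All (_≤ c) js) →
                     countᵇ p (tuples m b) ≡ countᵇ p (tuples m c)
count-tuples-bound {c} b m p c≤b p⇒≤c = go (≤⇒≤′ c≤b)
  where
  go : ∀ {b} → c ℕ.≤′ b → countᵇ p (tuples m b) ≡ countᵇ p (tuples m c)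
  go ℕ.≤′-refl         = refl
  go (ℕ.≤′-step c≤′b) = trans (count-tuples-suc _ m p (≤′⇒≤ c≤′b) p⇒≤c) (go c≤′b)

lin quad : List ℕ → ℕ
lin js  = linW (indexed js)
quad js = quadW (indexed js)

indexedFrom-∷ʳ : ∀ r ys x → indexedFrom r (ys ∷ʳ x) ≡ indexedFrom r ys ∷ʳ (r + length ys , x)
indexedFrom-∷ʳ r []       x = cong (λ i → (i , x) ∷ []) (sym (+-identityʳ r))
indexedFrom-∷ʳ r (y ∷ ys) x =
  cong ((r , y) ∷_) (trans (indexedFrom-∷ʳ (suc r) ys x)
                           (cong (λ i → indexedFrom (suc r) ys ∷ʳ (i , x)) (sym (+-suc r (length ys)))))

indexedFrom-index≤ : ∀ r ys → All (λ p → proj₁ p ≤ r + length ys) (indexedFrom r ys)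
indexedFrom-index≤ r []       = []
indexedFrom-index≤ r (y ∷ ys) =
  m≤m+n r _ ∷ All.map (λ i≤ → ≤-trans i≤ (≤-reflexive (sym (+-suc r (length ys)))))
                      (indexedFrom-index≤ (suc r) ys)

linW-∷ʳ : ∀ ps s x → linW (ps ∷ʳ (s , x)) ≡ linW ps + s * x
linW-∷ʳ ps s x = sum-map-∷ʳ (λ p → proj₁ p * proj₂ p) ps (s , x)

quadW-∷ʳ : ∀ ps s x → All (λ p → proj₁ p ≤ s) ps →
           quadW (ps ∷ʳ (s , x)) ≡ quadW ps + 2 * (linW ps * x) + s * x * x
quadW-∷ʳ ps s x indices≤s = begin
  sum (map (λ p → sum (map (w p) (ps ∷ʳ q))) (ps ∷ʳ q))
    ≡⟨ sum-map-∷ʳ _ ps q ⟩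
  sum (map (λ p → sum (map (w p) (ps ∷ʳ q))) ps) + sum (map (w q) (ps ∷ʳ q))
    ≡⟨ cong₂ _+_ (cong sum (map-cong (λ p → sum-map-∷ʳ (w p) ps q) ps)) (sum-map-∷ʳ (w q) ps q) ⟩
  sum (map (λ p → sum (map (w p) ps) + w p q) ps) + (sum (map (w q) ps) + w q q)
    ≡⟨ cong (_+ (sum (map (w q) ps) + w q q)) (sum-map-+ (λ p → sum (map (w p) ps)) (λ p → w p q) ps) ⟩
  quadW ps + sum (map (λ p → w p q) ps) + (sum (map (w q) ps) + w q q)
    ≡⟨ cong₂ (λ a b → quadW ps + a + (b + s ⊓ s * x * x)) new-on-right new-on-left ⟩
  quadW ps + linW ps * x + (linW ps * x + s ⊓ s * x * x)
    ≡⟨ cong (λ t → quadW ps + linW ps * x + (linW ps * x + t * x * x)) (⊓-idem s) ⟩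
  quadW ps + linW ps * x + (linW ps * x + s * x * x)
    ≡⟨ regroup (quadW ps) (linW ps * x) (s * x * x) ⟩
  quadW ps + 2 * (linW ps * x) + s * x * x ∎
  where
  open ≡-Reasoning
  w : ℕ × ℕ → ℕ × ℕ → ℕ
  w (r , j) (s , i) = (r ⊓ s) * j * i
  q = (s , x)
  regroup : ∀ a b c → a + b + (b + c) ≡ a + 2 * b + c
  regroup = solve-∀
  swap₂₃ : ∀ a b c → a * b * c ≡ a * c * b
  swap₂₃ = solve-∀
  new-on-right : sum (map (λ p → w p q) ps) ≡ linW ps * x
  new-on-right =
    trans (cong sum (map-cong-local (All.map (λ r≤s → cong (λ t → t * _ * x) (m≤n⇒m⊓n≡m r≤s)) indices≤s)))
          (sum-map-*ʳ (λ p → proj₁ p * proj₂ p) x ps)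
  new-on-left : sum (map (w q) ps) ≡ linW ps * x
  new-on-left =
    trans (cong sum (map-cong-local (All.map (λ {p} r≤s → trans (cong (λ t → t * x * proj₂ p) (m≥n⇒m⊓n≡n r≤s))
                                                                (swap₂₃ (proj₁ p) x (proj₂ p)))
                                             indices≤s)))
          (sum-map-*ʳ (λ p → proj₁ p * proj₂ p) x ps)

lin-∷ʳ : ∀ ys x → lin (ys ∷ʳ x) ≡ lin ys + suc (length ys) * x
lin-∷ʳ ys x = trans (cong linW (indexedFrom-∷ʳ 1 ys x)) (linW-∷ʳ (indexed ys) _ x)

quad-∷ʳ : ∀ ys x → quad (ys ∷ʳ x) ≡ quad ys + 2 * (lin ys * x) + suc (length ys) * x * x
quad-∷ʳ ys x =
  trans (cong quadW (indexedFrom-∷ʳ 1 ys x)) (quadW-∷ʳ (indexed ys) _ x (indexedFrom-index≤ 1 ys))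

2*length≤linW : ∀ r js → All (2 ≤_) js → 2 * length js ≤ linW (indexedFrom (suc r) js)
2*length≤linW r []       []           = ℕ.z≤n
2*length≤linW r (j ∷ js) (2≤j ∷ 2≤js) = begin
  2 * suc (length js)
    ≡⟨ *-suc 2 (length js) ⟩
  2 + 2 * length js
    ≤⟨ +-mono-≤ (≤-trans 2≤j (m≤n*m j (suc r))) (2*length≤linW (suc r) js 2≤js) ⟩
  suc r * j + linW (indexedFrom (2 + r) js) ∎
  where open ≤-Reasoning

entries≤linW : ∀ r js → All (_≤ linW (indexedFrom (suc r) js)) js
entries≤linW r []       = []
entries≤linW r (j ∷ js) =
  ≤-trans (m≤n*m j (suc r)) (m≤m+n _ _)
  ∷ All.map (λ j≤ → ≤-trans j≤ (m≤n+m _ _)) (entries≤linW (suc r) js)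

contributes≡admissible : ∀ m n k js →
                         contributes m n k js ≡ does (admissible? (+ m) n k (+ lin js) (+ quad js))
contributes≡admissible m n k js =
  cong₂ (λ a b → does (n ℤ.≟ + lin js - a) ∧ does (+ 2 ℤ.* k ℤ.≟ b))
        (ℤ.pos-* 2 m)
        (cong₂ _-_ (trans (ℤ.pos-+ (6 * m) (quad js)) (cong (ℤ._+ + quad js) (ℤ.pos-* 6 m)))
                   (ℤ.pos-* 5 (lin js)))

contributes-∷ʳ : ∀ ys x n k →
  contributes (suc (length ys)) n k (ys ∷ʳ x)
  ≡ does (admissible? (+ suc (length ys)) n k (+ lin ys ℤ.+ + suc (length ys) ℤ.* + x)
                      (+ quad ys ℤ.+ + 2 ℤ.* (+ lin ys ℤ.* + x) ℤ.+ + suc (length ys) ℤ.* + x ℤ.* + x))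
contributes-∷ʳ ys x n k =
  trans (contributes≡admissible (suc (length ys)) n k (ys ∷ʳ x))
        (cong₂ (λ L Q → does (admissible? (+ suc (length ys)) n k L Q))
               (trans (cong +_ (lin-∷ʳ ys x)) (pos-linear (lin ys) (suc (length ys)) x))
               (trans (cong +_ (quad-∷ʳ ys x)) (pos-quadratic (quad ys) (lin ys) (suc (length ys)) x)))
  where
  pos-linear : ∀ L s x → + (L + s * x) ≡ + L ℤ.+ + s ℤ.* + x
  pos-linear L s x = trans (ℤ.pos-+ L (s * x)) (cong (ℤ._+_ (+ L)) (ℤ.pos-* s x))
  pos-quadratic : ∀ Q L s x →
                  + (Q + 2 * (L * x) + s * x * x) ≡ + Q ℤ.+ + 2 ℤ.* (+ L ℤ.* + x) ℤ.+ + s ℤ.* + x ℤ.* + x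
  pos-quadratic Q L s x =
    trans (ℤ.pos-+ (Q + 2 * (L * x)) (s * x * x))
          (cong₂ ℤ._+_ (trans (ℤ.pos-+ Q (2 * (L * x)))
                              (cong (ℤ._+_ (+ Q)) (trans (ℤ.pos-* 2 (L * x)) (cong (ℤ._*_ (+ 2)) (ℤ.pos-* L x)))))
                       (trans (ℤ.pos-* (s * x) x) (cong (ℤ._* + x) (ℤ.pos-* s x))))

contributes-∷ʳ-2 : ∀ m n k ys → length ys ≡ m →
  let n₂ = n - + 2 ℤ.* + m
  in contributes (suc m) n k (ys ∷ʳ 2) ≡ contributes m n₂ (k - (+ m ℤ.+ + 2 ℤ.* n₂)) ys
contributes-∷ʳ-2 m n k ys refl =
  trans (contributes-∷ʳ ys 2 n k)
        (trans (does-⇔ (admissible-∷ʳ-2 (+ m) n k (+ lin ys) (+ quad ys))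
                       (admissible? _ _ _ _ _) (admissible? _ _ _ _ _))
               (sym (contributes≡admissible m n₂ (k - (+ m ℤ.+ + 2 ℤ.* n₂)) ys)))
  where
  n₂ = n - + 2 ℤ.* + m

contributes-∷ʳ-suc : ∀ m n k ys x → length ys ≡ m →
  contributes (suc m) n k (ys ∷ʳ suc x) ≡ contributes (suc m) (n - + suc m) (k - (n - + suc m)) (ys ∷ʳ x)
contributes-∷ʳ-suc m n k ys x refl =
  trans (contributes-∷ʳ ys (suc x) n k)
        (trans (does-⇔ (admissible-∷ʳ-suc (+ suc m) n k (+ lin ys) (+ quad ys) (+ x))
                       (admissible? _ _ _ _ _) (admissible? _ _ _ _ _))
               (sym (contributes-∷ʳ ys x n₁ (k - n₁))))
  where
  n₁ = n - + suc m

contributes-bounded : ∀ m n k js → contributes m n k js ≡ true → All (_≤ ∣ n ℤ.+ + 2 ℤ.* + m ∣) js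
contributes-bounded m n k js h = subst (λ c → All (_≤ c) js) (sym ∣n+2m∣≡lin) (entries≤linW 0 js)
  where
  minus-plus : ∀ a b → a - b ℤ.+ b ≡ a
  minus-plus = ℤ-Ring.solve-∀
  t-exponent : n ≡ + lin js - + 2 ℤ.* + m
  t-exponent = Admissible.t-exponent (does-true (admissible? (+ m) n k (+ lin js) (+ quad js))
                                                (trans (sym (contributes≡admissible m n k js)) h))
  ∣n+2m∣≡lin : ∣ n ℤ.+ + 2 ℤ.* + m ∣ ≡ lin js
  ∣n+2m∣≡lin =
    cong ∣_∣ (trans (cong (ℤ._+ + 2 ℤ.* + m) t-exponent) (minus-plus (+ lin js) (+ 2 ℤ.* + m)))

contributes-negative : ∀ m a k js → length js ≡ m → All (2 ≤_) js → contributes m -[1+ a ] k js ≡ false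
contributes-negative m a k js refl 2≤js rewrite pos-minus-≥ (2*length≤linW 0 js 2≤js) = refl

#contributing : ℕ → ℤ → ℤ → ℕ
#contributing m n k = countᵇ (contributes m n k) (tuples m (∣ n ∣ + 2 * m))

count-contributing-bound : ∀ m n k b → ∣ n ℤ.+ + 2 ℤ.* + m ∣ ≤ b →
                           countᵇ (contributes m n k) (tuples m b) ≡ #contributing m n k
count-contributing-bound m n k b c≤b =
  trans (count-tuples-bound b m _ c≤b (contributes-bounded m n k))
        (sym (count-tuples-bound (∣ n ∣ + 2 * m) m _ c≤∣n∣+2m (contributes-bounded m n k)))
  where
  c≤∣n∣+2m : ∣ n ℤ.+ + 2 ℤ.* + m ∣ ≤ ∣ n ∣ + 2 * m
  c≤∣n∣+2m = ≤-trans (ℤ.∣i+j∣≤∣i∣+∣j∣ n (+ 2 ℤ.* + m))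
                     (≤-reflexive (cong (λ j → ∣ n ∣ + ∣ j ∣) (sym (ℤ.pos-* 2 m))))

#contributing-negative : ∀ m a k → #contributing m -[1+ a ] k ≡ 0
#contributing-negative m a k =
  count-none (All.map (λ (len , 2≤js) → contributes-negative m a k _ len 2≤js)
                      (listsOver-All m (All-range2 (suc a + 2 * m))))

count-contributes-by-last-entry : ∀ m n k d → ∣ n ℤ.+ + suc m ∣ ≤ suc d →
  let n₁ = n - + suc m
      n₂ = n - + 2 ℤ.* + m
  in countᵇ (contributes (suc m) n k) (tuples (suc m) (2 + d))
     ≡ countᵇ (contributes m n₂ (k - (+ m ℤ.+ + 2 ℤ.* n₂))) (tuples m (2 + d))
       + countᵇ (contributes (suc m) n₁ (k - n₁)) (tuples (suc m) (suc d))
count-contributes-by-last-entry m n k d ∣n+m+1∣≤1+d = begin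
  countᵇ P (tuples (suc m) (2 + d))
    ≡⟨ count-listsOver-∷ʳ P (range2 (2 + d)) m ⟩
  sum (map F (range2 (2 + d)))
    ≡⟨ cong (sum ∘ map F) (range2-2∷ d) ⟩
  F 2 + sum (map F (map suc (range2 (suc d))))
    ≡⟨ cong₂ _+_ last-is-2 (trans (cong sum (sym (map-∘ (range2 (suc d)))))
                                  (cong sum (map-cong decrement (range2 (suc d))))) ⟩
  countᵇ P₂ T + sum (map (λ x → countᵇ (P₁ ∘ (_∷ʳ x)) (tuples m (suc d))) (range2 (suc d)))
    ≡⟨ cong (_+_ (countᵇ P₂ T)) (count-listsOver-∷ʳ P₁ (range2 (suc d)) m) ⟨
  countᵇ P₂ T + countᵇ P₁ (tuples (suc m) (suc d)) ∎
  where
  open ≡-Reasoning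
  n₁ = n - + suc m
  n₂ = n - + 2 ℤ.* + m
  P  = contributes (suc m) n k
  P₁ = contributes (suc m) n₁ (k - n₁)
  P₂ = contributes m n₂ (k - (+ m ℤ.+ + 2 ℤ.* n₂))
  T  = tuples m (2 + d)
  F : ℕ → ℕ
  F x = countᵇ (P ∘ (_∷ʳ x)) T
  last-is-2 : F 2 ≡ countᵇ P₂ T
  last-is-2 = count-listsOver-cong m (All-range2 (2 + d)) (λ ys len _ → contributes-∷ʳ-2 m n k ys len)
  P₁-bounded : ∀ js → P₁ js ≡ true → All (_≤ suc d) js
  P₁-bounded js h =
    All.map (λ j≤ → ≤-trans j≤ (≤-trans (≤-reflexive (cong ∣_∣ (shift n (+ suc m)))) ∣n+m+1∣≤1+d))
            (contributes-bounded (suc m) n₁ (k - n₁) js h)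
    where
    shift : ∀ n s → n - s ℤ.+ + 2 ℤ.* s ≡ n ℤ.+ s
    shift = ℤ-Ring.solve-∀
  decrement : ∀ x → F (suc x) ≡ countᵇ (P₁ ∘ (_∷ʳ x)) (tuples m (suc d))
  decrement x =
    trans (count-listsOver-cong m (All-range2 (2 + d)) (λ ys len _ → contributes-∷ʳ-suc m n k ys x len))
          (count-tuples-bound (2 + d) m (P₁ ∘ (_∷ʳ x)) (n≤1+n (suc d))
                              (λ ys h → All.++⁻ˡ ys (P₁-bounded (ys ∷ʳ x) h)))

#contributing-suc : ∀ m n k →
  let n₁ = n - + suc m
      n₂ = n - + 2 ℤ.* + m
  in #contributing (suc m) n k
     ≡ #contributing m n₂ (k - (+ m ℤ.+ + 2 ℤ.* n₂)) + #contributing (suc m) n₁ (k - n₁)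
#contributing-suc m n k = begin
  #contributing (suc m) n k
    ≡⟨ count-contributing-bound (suc m) n k (2 + d) (≤-trans (ℤ.∣i+j∣≤∣i∣+∣j∣ n _) (m≤n+m _ 2)) ⟨
  countᵇ (contributes (suc m) n k) (tuples (suc m) (2 + d))
    ≡⟨ count-contributes-by-last-entry m n k d ∣n+m+1∣≤1+d ⟩
  countᵇ (contributes m n₂ k₂) (tuples m (2 + d))
  + countᵇ (contributes (suc m) n₁ k₁) (tuples (suc m) (suc d))
    ≡⟨ cong₂ _+_ (count-contributing-bound m n₂ k₂ (2 + d) ∣n₂+2m∣≤2+d)
                 (count-contributing-bound (suc m) n₁ k₁ (suc d) ∣n₁+2m+2∣≤1+d) ⟩
  #contributing m n₂ k₂ + #contributing (suc m) n₁ k₁ ∎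
  where
  open ≡-Reasoning
  n₁ = n - + suc m
  k₁ = k - n₁
  n₂ = n - + 2 ℤ.* + m
  k₂ = k - (+ m ℤ.+ + 2 ℤ.* n₂)
  d = ∣ n ∣ + 2 * suc m
  ∣n+m+1∣≤1+d : ∣ n ℤ.+ + suc m ∣ ≤ suc d
  ∣n+m+1∣≤1+d =
    ≤-trans (ℤ.∣i+j∣≤∣i∣+∣j∣ n (+ suc m)) (≤-trans (+-monoʳ-≤ ∣ n ∣ (m≤n*m (suc m) 2)) (n≤1+n d))
  ∣n₁+2m+2∣≤1+d : ∣ n₁ ℤ.+ + 2 ℤ.* + suc m ∣ ≤ suc d
  ∣n₁+2m+2∣≤1+d = subst (λ i → ∣ i ∣ ≤ suc d) (sym (shift n (+ suc m))) ∣n+m+1∣≤1+d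
    where
    shift : ∀ n s → n - s ℤ.+ + 2 ℤ.* s ≡ n ℤ.+ s
    shift = ℤ-Ring.solve-∀
  ∣n₂+2m∣≤2+d : ∣ n₂ ℤ.+ + 2 ℤ.* + m ∣ ≤ 2 + d
  ∣n₂+2m∣≤2+d =
    subst (λ i → ∣ i ∣ ≤ 2 + d) (sym (unshift n (+ 2 ℤ.* + m))) (≤-trans (m≤m+n ∣ n ∣ _) (m≤n+m d 2))
    where
    unshift : ∀ n s → n - s ℤ.+ s ≡ n
    unshift = ℤ-Ring.solve-∀

sign-suc-distrib : ∀ m x y → sign (suc m) ℤ.* + (y + x) ≡ sign (suc m) ℤ.* + x - sign m ℤ.* + y
sign-suc-distrib m x y = trans (cong (sign (suc m) ℤ.*_) (ℤ.pos-+ y x)) (distrib (sign m) (+ x) (+ y))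
  where
  distrib : ∀ s x y → (ℤ.- s) ℤ.* (y ℤ.+ x) ≡ (ℤ.- s) ℤ.* x - s ℤ.* y
  distrib = ℤ-Ring.solve-∀

does-2*k≟0 : ∀ k → does (+ 2 ℤ.* k ℤ.≟ + 0) ≡ does (k ℤ.≟ + 0)
does-2*k≟0 (+ zero)  = refl
does-2*k≟0 (+ suc _) = refl
does-2*k≟0 -[1+ _ ]  = refl

rhsCoeff≡#contributing : ∀ m n k → rhsCoeff m n k ≡ sign m ℤ.* + #contributing m n k
rhsCoeff≡#contributing zero    n k rewrite does-2*k≟0 k with does (n ℤ.≟ + 0) ∧ does (k ℤ.≟ + 0)
... | true  = refl
... | false = refl
rhsCoeff≡#contributing (suc m) n k = refl

extend-pos-minus : ∀ (B : Series) m n c d →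
                   (if d ≤ᵇ c then B m n (c ∸ d) else + 0) ≡ extend B m (+ n) (+ c - + d)
extend-pos-minus B m n c d with d ≤ᵇ c | + c - + d | differenceView c d
... | true  | _ | nonneg _ = refl
... | false | _ | neg      = refl

extend-neg-minus : ∀ (B : Series) m n c e → extend B m n (-[1+ c ] - + e) ≡ + 0
extend-neg-minus B m (+ _)    c e rewrite ℤ.neg-minus-pos c e = refl
extend-neg-minus B m -[1+ _ ] c e = refl

substA≡extend : ∀ (B : Series) s a c → substA B s a c ≡ extend B s (+ a - + s) (+ c - (+ a - + s))
substA≡extend B s a c with s ≤ᵇ a | + a - + s | differenceView a s
... | true  | _ | nonneg _ = extend-pos-minus B s (a ∸ s) c (a ∸ s)
... | false | _ | neg      = refl

substB≡extend : ∀ (B : Series) m a c →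
  substB B (suc m) a c ≡ extend B m (+ a - + 2 ℤ.* + m) (+ c - (+ m ℤ.+ + 2 ℤ.* (+ a - + 2 ℤ.* + m)))
substB≡extend B m a c rewrite sym (ℤ.pos-* 2 m) with 2 * m ≤ᵇ a | + a - + (2 * m) | differenceView a (2 * m)
... | true  | _ | nonneg _ rewrite sym (ℤ.pos-* 2 (a ∸ 2 * m)) =
  extend-pos-minus B m (a ∸ 2 * m) c (m + 2 * (a ∸ 2 * m))
... | false | _ | neg      = refl

extend-solves : ∀ (B : Series) → (∀ n k → B 0 n k ≡ oneCoeff n k) →
                (∀ m n k → B m n k ≡ substA B m n k - substB B m n k) → SolvesRecurrence (extend B)
extend-solves B B₀ B-rec = record { initial = initial ; negative = λ _ _ _ → refl ; step = step }
  where
  initial : ∀ n k → extend B 0 n k ≡ rhsCoeff 0 n k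
  initial (+ n)       (+ k)    = trans (B₀ n k) (oneCoeff≡rhsCoeff n k)
    where
    oneCoeff≡rhsCoeff : ∀ n k → oneCoeff n k ≡ rhsCoeff 0 (+ n) (+ k)
    oneCoeff≡rhsCoeff zero    zero    = refl
    oneCoeff≡rhsCoeff zero    (suc _) = refl
    oneCoeff≡rhsCoeff (suc _) zero    = refl
    oneCoeff≡rhsCoeff (suc _) (suc _) = refl
  initial (+ zero)    -[1+ _ ] = refl
  initial (+ suc _)   -[1+ _ ] = refl
  initial -[1+ _ ]    _        = refl
  shiftedA-negative : ∀ s a c → extend B s (+ a - + s) (-[1+ c ] - (+ a - + s)) ≡ + 0
  shiftedA-negative s a c with s ≤ᵇ a | + a - + s | differenceView a s
  ... | true  | _ | nonneg _ = extend-neg-minus B s (+ (a ∸ s)) c (a ∸ s)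
  ... | false | _ | neg      = refl
  shiftedB-negative : ∀ m a c → let n₂ = + a - + 2 ℤ.* + m in extend B m n₂ (-[1+ c ] - (+ m ℤ.+ + 2 ℤ.* n₂)) ≡ + 0
  shiftedB-negative m a c rewrite sym (ℤ.pos-* 2 m) with 2 * m ≤ᵇ a | + a - + (2 * m) | differenceView a (2 * m)
  ... | true  | _ | nonneg _ rewrite sym (ℤ.pos-* 2 (a ∸ 2 * m)) =
    extend-neg-minus B m (+ (a ∸ 2 * m)) c (m + 2 * (a ∸ 2 * m))
  ... | false | _ | neg      = refl
  step : ∀ m n k → Recurrence (extend B) m n k
  step m (+ a) (+ c) =
    trans (B-rec (suc m) a c) (cong₂ _-_ (substA≡extend B (suc m) a c) (substB≡extend B m a c))
  step m (+ a) -[1+ c ] = sym (cong₂ _-_ (shiftedA-negative (suc m) a c) (shiftedB-negative m a c))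
  step m -[1+ a ] k =
    sym (cong₂ _-_ (extend-neg-minus-n (suc m) a (suc m) (k - (-[1+ a ] - + suc m)))
                   (trans (cong (λ e → extend B m (-[1+ a ] - e) k₂) (sym (ℤ.pos-* 2 m)))
                          (extend-neg-minus-n m a (2 * m) k₂)))
    where
    k₂ = k - (+ m ℤ.+ + 2 ℤ.* (-[1+ a ] - + 2 ℤ.* + m))
    extend-neg-minus-n : ∀ m a e k → extend B m (-[1+ a ] - + e) k ≡ + 0
    extend-neg-minus-n m a e k rewrite ℤ.neg-minus-pos a e = refl

rhsCoeff-solves : SolvesRecurrence rhsCoeff
rhsCoeff-solves = record { initial = λ _ _ → refl ; negative = negative ; step = step }
  where
  negative : ∀ m a k → rhsCoeff m -[1+ a ] k ≡ + 0
  negative m a k = trans (rhsCoeff≡#contributing m _ k)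
                         (trans (cong (λ c → sign m ℤ.* + c) (#contributing-negative m a k)) (ℤ.*-zeroʳ (sign m)))
  step : ∀ m n k → Recurrence rhsCoeff m n k
  step m n k = trans (cong (λ c → sign (suc m) ℤ.* + c) (#contributing-suc m n k))
                     (trans (sign-suc-distrib m _ _)
                            (cong (_-_ (rhsCoeff (suc m) n₁ (k - n₁))) (sym (rhsCoeff≡#contributing m _ _))))
    where
    n₁ = n - + suc m

theorem2 : (B : Series)
    → (∀ n k → B 0 n k ≡ oneCoeff n k)
    → (∀ m n k → B m n k ≡ substA B m n k - substB B m n k)
    → ∀ (m : ℕ) (n k : ℤ) → extend B m n k ≡ rhsCoeff m n k
theorem2 B B₀ B-rec = solutions-agree (extend-solves B B₀ B-rec) rhsCoeff-solves
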